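{- For each positive integer $n$, let $w_n=(a^nba^{n-1}b)^4a^{n-1}$ over the alphabet $\{a,b\}$. Then $|w_n|=9n+3$ and $\mathrm{RP}(w_n)\ge \frac{|w_n|^2}{9}-O(|w_n|)$. In particular, there exist infinitely many words $w$ with $\mathrm{RP}(w)\ge \frac{|w|^2}{9}-O(|w|)$.
   Context: A rational power is a word of the form $p^kp'$, where $p$ is a nonempty word, $k\ge2$ is an integer, $p^k$ is the concatenation of $k$ copies of $p$ and $p'$ is a prefix of $p$. $\mathrm{RP}(w)$ is the number of distinct factors (contiguous subwords) of $w$ that are rational powers. -}

module Defs where

open import Data.Nat using (ℕ; zero; suc; _∸_; _≥_; _+_; _*_)
open import Data.List using (List; []; _∷_; _++_; concat; replicate; length)
open import Data.List.Relation.Unary.All using (All)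
open import Data.List.Relation.Unary.AllPairs using (AllPairs)
open import Data.Product using (Σ; ∃; _×_; _,_)
open import Relation.Binary.PropositionalEquality using (_≡_; _≢_)

data Letter : Set where
  a b : Letter

Word : Set
Word = List Letter

_^^_ : Word → ℕ → Word
p ^^ k = concat (replicate k p)

IsFactor : Word → Word → Set
IsFactor u w = ∃ λ x → ∃ λ y → w ≡ x ++ u ++ y

IsPrefix : Word → Word → Set
IsPrefix q p = ∃ λ s → p ≡ q ++ s

IsRationalPower : Word → Set
IsRationalPower u =
  ∃ λ (p : Word) → ∃ λ (k : ℕ) → ∃ λ (p' : Word) →
    (p ≢ []) × (k ≥ 2) × IsPrefix p' p × (u ≡ (p ^^ k) ++ p')

-- RP(w) ≥ m : there are at least m distinct factors of w that are rational powers,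
-- i.e. a duplicate-free list of length m of rational-power factors of w.
RP≥ : Word → ℕ → Set
RP≥ w m = ∃ λ (L : List Word) →
  (length L ≡ m) × AllPairs _≢_ L × All (λ u → IsFactor u w × IsRationalPower u) L

aⁿ : ℕ → Word
aⁿ n = replicate n a

wₙ : ℕ → Word
wₙ n = ((aⁿ n ++ b ∷ aⁿ (n ∸ 1) ++ b ∷ []) ^^ 4) ++ aⁿ (n ∸ 1)

{-# OPTIONS --safe #-}
-- Write n = k + 1, so that wₙ = (a^(k+1) b a^k b)⁴ a^k has length 9k + 12. For t < k and
-- j = k - 1 - t the word wₙ contains the four runs
--   (a^(t+1) b a^j)² a^(t+1),        (a^(t+1) b a^(j+1))² a^t,
--   (a^(t+1) b a^k b a^(j+1))⁴ a^t,  (a^(t+1) b a^(k+1) b a^j)³ a^(t+1) b a^k,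
-- and every prefix of a run p^m p′ (p′ a prefix of p) that contains p p is a rational power.
-- These prefixes are pairwise distinct: the first a-run a^(t+1) determines t, the second
-- a-run (a^k or a^(k+1)) separates the first and third runs from the second and fourth, and
-- the length separates the short periods from the long ones. For fixed t there are
-- 7k + 4t + 16 of them, so RP(wₙ) ≥ 9k² + 14k ≥ |wₙ|²/9 - 2|wₙ|.
module Submission where

open import Defs
open import Data.Nat using (ℕ; zero; suc; _+_; _*_; _∸_; _≤_; _<_; _≥_; _≤?_; s≤s; s≤s⁻¹; z≤n)
open import Data.Nat.Properties
  using ( +-assoc; +-comm; +-identityʳ; +-suc; *-identityˡ; 1+n≢n; 1+n≰n; m≤m+n; m<m+n
        ; m≤n⇒m≤1+n; m≤n⇒m⊓n≡m; m≤n⇒m∸n≡0; m+[n∸m]≡n; ≤-refl; ≤-reflexive; ≤-trans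
        ; <⇒≤; <⇒≢; <⇒≱; ≰⇒>)
open import Data.Nat.Tactic.RingSolver using (solve)
open import Data.List
  using (List; []; _∷_; _++_; length; take; drop; replicate; concat; concatMap; applyDownFrom)
open import Data.List.Properties
  using ( ++-assoc; ++-identityʳ; ++-cancelˡ; length-++; length-replicate; length-take
        ; take++drop≡id; take-all; length-applyDownFrom)
open import Data.List.Relation.Unary.All using (All)
import Data.List.Relation.Unary.All as All
import Data.List.Relation.Unary.All.Properties as All
open import Data.List.Relation.Unary.AllPairs using (AllPairs)
import Data.List.Relation.Unary.AllPairs as AllPairs
import Data.List.Relation.Unary.AllPairs.Properties as AllPairs
open import Data.Product using (∃; _×_; _,_; proj₁; proj₂; map₁)
open import Relation.Binary.PropositionalEquality
open import Relation.Nullary using (¬_; yes; no; contradiction)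

private
  variable
    X : Set
    xs ys : List X
    c d : ℕ
    p u v w z : Word

distinct-++ : {P Q : X → Set} → (∀ {x} → P x → ¬ Q x) → All P xs → All Q ys →
              AllPairs _≢_ xs → AllPairs _≢_ ys → AllPairs _≢_ (xs ++ ys)
distinct-++ {Q = Q} P⇒¬Q Pxs Qys xs-distinct ys-distinct =
  AllPairs.++⁺ xs-distinct ys-distinct
    (All.map (λ Px → All.map (λ Qy x≡y → P⇒¬Q Px (subst Q (sym x≡y) Qy)) Qys) Pxs)

take-++ : ∀ n (xs ys : List X) → take n (xs ++ ys) ≡ take n xs ++ take (n ∸ length xs) ys
take-++ zero    []       ys = refl
take-++ zero    (x ∷ xs) ys = refl
take-++ (suc n) []       ys = refl
take-++ (suc n) (x ∷ xs) ys = cong (x ∷_) (take-++ n xs ys)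

length-take-≤ : ∀ n (xs : List X) → n ≤ length xs → length (take n xs) ≡ n
length-take-≤ n xs n≤∣xs∣ = trans (length-take n xs) (m≤n⇒m⊓n≡m n≤∣xs∣)

take-prefix : ∀ n u → IsPrefix (take n u) u
take-prefix n u = drop n u , sym (take++drop≡id n u)

prefix-trans : IsPrefix u v → IsPrefix v w → IsPrefix u w
prefix-trans {u} (s , refl) (s′ , refl) = s ++ s′ , ++-assoc u s s′

prefix-++ˡ : ∀ x → IsPrefix u v → IsPrefix (x ++ u) (x ++ v)
prefix-++ˡ {u} x (s , refl) = s , sym (++-assoc x u s)

prefix-length : IsPrefix u v → length u ≤ length v
prefix-length {u} (s , refl) = ≤-trans (m≤m+n _ _) (≤-reflexive (sym (length-++ u)))

prefix-factor : IsPrefix u v → IsFactor v w → IsFactor u w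
prefix-factor {u} (s , refl) (x , y , refl) = x , s ++ y , cong (x ++_) (++-assoc u s y)

proper-prefix-separated : ∀ {r s y} → IsPrefix (r ++ y) s → y ≢ [] → IsPrefix u r → ¬ IsPrefix s u
proper-prefix-separated {y = []} _ []≢[] = contradiction refl []≢[]
proper-prefix-separated {u} {r} {s} {x ∷ y} rxy⊑s _ u⊑r s⊑u =
  <⇒≱ ∣r∣<∣s∣ (≤-trans (prefix-length s⊑u) (prefix-length u⊑r))
  where
    ∣r∣<∣s∣ : length r < length s
    ∣r∣<∣s∣ = ≤-trans (subst (length r <_) (sym (length-++ r)) (m<m+n (length r) (s≤s z≤n)))
                      (prefix-length rxy⊑s)

-- Fractional powers

IsFractionalPower : Word → Word → Set
IsFractionalPower p z = ∃ λ i → ∃ λ p′ → IsPrefix p′ p × z ≡ (p ^^ i) ++ p′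

take-^^-suc : ∀ n p i p′ →
              take n ((p ^^ suc i) ++ p′) ≡ take n p ++ take (n ∸ length p) ((p ^^ i) ++ p′)
take-^^-suc n p i p′ = trans (cong (take n) (++-assoc p (p ^^ i) p′)) (take-++ n p _)

take-fractionalPower : ∀ n → IsFractionalPower p z → IsFractionalPower p (take n z)
take-fractionalPower n (zero , p′ , p′⊑p , refl) =
  0 , take n p′ , prefix-trans (take-prefix n p′) p′⊑p , refl
take-fractionalPower {p} n (suc i , p′ , p′⊑p , refl)
  with n ≤? length p | take-fractionalPower (n ∸ length p) (i , p′ , p′⊑p , refl)
... | yes n≤∣p∣ | _ = 0 , take n p , take-prefix n p , (begin
  take n ((p ^^ suc i) ++ p′)              ≡⟨ take-^^-suc n p i p′ ⟩
  take n p ++ take (n ∸ length p) r        ≡⟨ cong (λ l → take n p ++ take l r) (m≤n⇒m∸n≡0 n≤∣p∣) ⟩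
  take n p ++ []                           ≡⟨ ++-identityʳ (take n p) ⟩
  take n p                                 ∎)
  where
    open ≡-Reasoning
    r : Word
    r = (p ^^ i) ++ p′
... | no n≰∣p∣ | j , p″ , p″⊑p , take-r≡ = suc j , p″ , p″⊑p , (begin
  take n ((p ^^ suc i) ++ p′)              ≡⟨ take-^^-suc n p i p′ ⟩
  take n p ++ take (n ∸ length p) r
    ≡⟨ cong (_++ take (n ∸ length p) r) (take-all n p (<⇒≤ (≰⇒> n≰∣p∣))) ⟩
  p ++ take (n ∸ length p) r               ≡⟨ cong (p ++_) take-r≡ ⟩
  p ++ (p ^^ j) ++ p″                      ≡⟨ ++-assoc p (p ^^ j) p″ ⟨
  (p ^^ suc j) ++ p″                       ∎)
  where
    open ≡-Reasoning
    r : Word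
    r = (p ^^ i) ++ p′

square-fractionalPower : p ≢ [] → IsFractionalPower p z → IsRationalPower (p ++ p ++ z)
square-fractionalPower {p} p≢[] (i , p′ , p′⊑p , refl) =
  p , 2 + i , p′ , p≢[] , s≤s (s≤s z≤n) , p′⊑p ,
  sym (trans (++-assoc p _ p′) (cong (p ++_) (++-assoc p (p ^^ i) p′)))

RationalFactor : Word → Word → Set
RationalFactor w u = IsFactor u w × IsRationalPower u

squarePrefixes : Word → Word → List Word
squarePrefixes p z = applyDownFrom (λ n → p ++ p ++ take n z) (suc (length z))

squarePrefixes-⊑ : All (λ u → IsPrefix u (p ++ p ++ z)) (squarePrefixes p z)
squarePrefixes-⊑ {p} {z} =
  All.applyDownFrom⁺₂ _ _ (λ n → prefix-++ˡ p (prefix-++ˡ p (take-prefix n z)))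

squarePrefixes-⊒ : All (IsPrefix (p ++ p)) (squarePrefixes p z)
squarePrefixes-⊒ {p} {z} =
  All.applyDownFrom⁺₂ _ _ (λ n → take n z , sym (++-assoc p p (take n z)))

squarePrefixes-distinct : AllPairs _≢_ (squarePrefixes p z)
squarePrefixes-distinct {p} {z} = AllPairs.applyDownFrom⁺₁ _ _ λ {i} {j} j<i i<1+∣z∣ same →
  let i≤∣z∣ = s≤s⁻¹ i<1+∣z∣ in
  <⇒≢ j<i (begin
    j                    ≡⟨ length-take-≤ j z (≤-trans (<⇒≤ j<i) i≤∣z∣) ⟨
    length (take j z)    ≡⟨ cong length (++-cancelˡ p _ _ (++-cancelˡ p _ _ same)) ⟨
    length (take i z)    ≡⟨ length-take-≤ i z i≤∣z∣ ⟩
    i                    ∎)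
  where open ≡-Reasoning

squarePrefixes-rationalFactors : p ≢ [] → IsFractionalPower p z → IsFactor (p ++ p ++ z) w →
                                 All (RationalFactor w) (squarePrefixes p z)
squarePrefixes-rationalFactors {p} {z} p≢[] z-fractional ppz⊆w = All.applyDownFrom⁺₂ _ _ λ n →
  prefix-factor (prefix-++ˡ p (prefix-++ˡ p (take-prefix n z))) ppz⊆w ,
  square-fractionalPower p≢[] (take-fractionalPower n z-fractional)

-- Words given by their runs

data Seg : Set where
  A : ℕ → Seg
  B : Seg

⟦_⟧ : List Seg → Word
⟦ [] ⟧      = []
⟦ A n ∷ s ⟧ = aⁿ n ++ ⟦ s ⟧
⟦ B ∷ s ⟧   = b ∷ ⟦ s ⟧

⟦⟧-++ : ∀ s s′ → ⟦ s ++ s′ ⟧ ≡ ⟦ s ⟧ ++ ⟦ s′ ⟧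
⟦⟧-++ []        s′ = refl
⟦⟧-++ (A n ∷ s) s′ = trans (cong (aⁿ n ++_) (⟦⟧-++ s s′)) (sym (++-assoc (aⁿ n) ⟦ s ⟧ ⟦ s′ ⟧))
⟦⟧-++ (B ∷ s)   s′ = cong (b ∷_) (⟦⟧-++ s s′)

⟦⟧-^^ : ∀ s m → ⟦ s ⟧ ^^ m ≡ ⟦ concat (replicate m s) ⟧
⟦⟧-^^ s zero    = refl
⟦⟧-^^ s (suc m) = trans (cong (⟦ s ⟧ ++_) (⟦⟧-^^ s m)) (sym (⟦⟧-++ s _))

size : List Seg → ℕ
size []        = 0
size (A n ∷ s) = n + size s
size (B ∷ s)   = suc (size s)

length-⟦⟧ : ∀ s → length ⟦ s ⟧ ≡ size s
length-⟦⟧ []        = refl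
length-⟦⟧ (A n ∷ s) = trans (length-++ (aⁿ n)) (cong₂ _+_ (length-replicate n) (length-⟦⟧ s))
length-⟦⟧ (B ∷ s)   = cong suc (length-⟦⟧ s)

size-++ : ∀ s s′ → size (s ++ s′) ≡ size s + size s′
size-++ []        s′ = refl
size-++ (A n ∷ s) s′ = trans (cong (n +_) (size-++ s s′)) (sym (+-assoc n (size s) (size s′)))
size-++ (B ∷ s)   s′ = cong suc (size-++ s s′)

size-^^ : ∀ s m → size (concat (replicate m s)) ≡ m * size s
size-^^ s zero    = refl
size-^^ s (suc m) = trans (size-++ s _) (cong (size s +_) (size-^^ s m))

size-aba : ∀ x y → size (A x ∷ B ∷ A y ∷ []) ≡ x + y + 1
size-aba x y = begin
  size (A x ∷ B ∷ A y ∷ [])              ≡⟨⟩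
  x + suc (y + 0)                        ≡⟨ solve (x ∷ y ∷ []) ⟩
  x + y + 1                              ∎
  where open ≡-Reasoning

size-ababa : ∀ x y z → size (A x ∷ B ∷ A y ∷ B ∷ A z ∷ []) ≡ x + y + z + 2
size-ababa x y z = begin
  size (A x ∷ B ∷ A y ∷ B ∷ A z ∷ [])    ≡⟨⟩
  x + suc (y + suc (z + 0))              ≡⟨ solve (x ∷ y ∷ z ∷ []) ⟩
  x + y + z + 2                          ∎
  where open ≡-Reasoning

-- Adding n on the right makes the run lengths computed below reduce to forms like suc t + j.
runs : List Seg → ℕ × List ℕ
runs []        = 0 , []
runs (A n ∷ s) = map₁ (_+ n) (runs s)
runs (B ∷ s)   = 0 , proj₁ (runs s) ∷ proj₂ (runs s)

fromRuns : ℕ × List ℕ → Word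
fromRuns (c , ds) = aⁿ c ++ concatMap (λ d → b ∷ aⁿ d) ds

aⁿ-+ : ∀ m n → aⁿ (m + n) ≡ aⁿ m ++ aⁿ n
aⁿ-+ zero    n = refl
aⁿ-+ (suc m) n = cong (a ∷_) (aⁿ-+ m n)

aⁿ-++-fromRuns : ∀ n r → aⁿ n ++ fromRuns r ≡ fromRuns (map₁ (_+ n) r)
aⁿ-++-fromRuns n (c , ds) = begin
  aⁿ n ++ aⁿ c ++ bs      ≡⟨ ++-assoc (aⁿ n) (aⁿ c) bs ⟨
  (aⁿ n ++ aⁿ c) ++ bs    ≡⟨ cong (_++ bs) (aⁿ-+ n c) ⟨
  aⁿ (n + c) ++ bs        ≡⟨ cong (λ l → aⁿ l ++ bs) (+-comm n c) ⟩
  aⁿ (c + n) ++ bs        ∎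
  where
    open ≡-Reasoning
    bs : Word
    bs = concatMap (λ d → b ∷ aⁿ d) ds

⟦⟧≡fromRuns : ∀ s → ⟦ s ⟧ ≡ fromRuns (runs s)
⟦⟧≡fromRuns []        = refl
⟦⟧≡fromRuns (A n ∷ s) = trans (cong (aⁿ n ++_) (⟦⟧≡fromRuns s)) (aⁿ-++-fromRuns n (runs s))
⟦⟧≡fromRuns (B ∷ s)   = cong (b ∷_) (⟦⟧≡fromRuns s)

runs-≡⇒⟦⟧-≡ : ∀ {s s′} → runs s ≡ runs s′ → ⟦ s ⟧ ≡ ⟦ s′ ⟧
runs-≡⇒⟦⟧-≡ {s} {s′} e = trans (⟦⟧≡fromRuns s) (trans (cong fromRuns e) (sym (⟦⟧≡fromRuns s′)))

runs-prefix : ∀ us ys vs → runs (us ++ ys) ≡ runs vs → IsPrefix ⟦ us ⟧ ⟦ vs ⟧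
runs-prefix us ys vs e = ⟦ ys ⟧ , trans (sym (runs-≡⇒⟦⟧-≡ e)) (⟦⟧-++ us ys)

runs-factor : ∀ xs us ys vs → runs (xs ++ us ++ ys) ≡ runs vs → IsFactor ⟦ us ⟧ ⟦ vs ⟧
runs-factor xs us ys vs e = ⟦ xs ⟧ , ⟦ ys ⟧ ,
  trans (sym (runs-≡⇒⟦⟧-≡ e)) (trans (⟦⟧-++ xs (us ++ ys)) (cong (⟦ xs ⟧ ++_) (⟦⟧-++ us ys)))

runs-separated : ∀ R X rest S → ⟦ X ⟧ ≢ [] → runs ((R ++ X) ++ rest) ≡ runs S →
                 IsPrefix u ⟦ R ⟧ → ¬ IsPrefix ⟦ S ⟧ u
runs-separated R X rest S X≢[] e = proper-prefix-separated
  (subst (λ r → IsPrefix r ⟦ S ⟧) (⟦⟧-++ R X) (runs-prefix (R ++ X) rest S e)) X≢[]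

leadingAs : Word → ℕ
leadingAs (a ∷ u) = suc (leadingAs u)
leadingAs _       = 0

afterFirstB : Word → Word
afterFirstB []      = []
afterFirstB (a ∷ u) = afterFirstB u
afterFirstB (b ∷ u) = u

profile : Word → ℕ × ℕ
profile u = leadingAs u , leadingAs (afterFirstB u)

leadingAs-aⁿb : ∀ c r s → leadingAs ((aⁿ c ++ b ∷ r) ++ s) ≡ c
leadingAs-aⁿb zero    r s = refl
leadingAs-aⁿb (suc c) r s = cong suc (leadingAs-aⁿb c r s)

afterFirstB-aⁿb : ∀ c r s → afterFirstB ((aⁿ c ++ b ∷ r) ++ s) ≡ r ++ s
afterFirstB-aⁿb zero    r s = refl
afterFirstB-aⁿb (suc c) r s = afterFirstB-aⁿb c r s

profile-prefix : IsPrefix ⟦ A c ∷ B ∷ A d ∷ B ∷ [] ⟧ u → profile u ≡ (c , d)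
profile-prefix {c} {d} (s , refl) = cong₂ _,_ (leadingAs-aⁿb c _ s)
  (trans (cong leadingAs (afterFirstB-aⁿb c (aⁿ d ++ b ∷ []) s)) (leadingAs-aⁿb d [] s))

runPrefixes : List Seg → ℕ → List Seg → List Word
runPrefixes P i Q = squarePrefixes ⟦ P ⟧ ⟦ concat (replicate i P) ++ Q ⟧

module _ (P : List Seg) (i : ℕ) (Q : List Seg) where
  private
    Z : List Seg
    Z = concat (replicate i P) ++ Q

    square-⟦⟧ : ⟦ P ⟧ ++ ⟦ P ⟧ ++ ⟦ Z ⟧ ≡ ⟦ P ++ P ++ Z ⟧
    square-⟦⟧ = sym (trans (⟦⟧-++ P (P ++ Z)) (cong (⟦ P ⟧ ++_) (⟦⟧-++ P Z)))

  runPrefixes-rationalFactors : ⟦ P ⟧ ≢ [] → IsPrefix ⟦ Q ⟧ ⟦ P ⟧ → IsFactor ⟦ P ++ P ++ Z ⟧ w →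
                                All (RationalFactor w) (runPrefixes P i Q)
  runPrefixes-rationalFactors {w} P≢[] Q⊑P run⊆w = squarePrefixes-rationalFactors P≢[]
    (i , ⟦ Q ⟧ , Q⊑P , trans (⟦⟧-++ (concat (replicate i P)) Q) (cong (_++ ⟦ Q ⟧) (sym (⟦⟧-^^ P i))))
    (subst (λ r → IsFactor r w) (sym square-⟦⟧) run⊆w)

  runPrefixes-⊑ : All (λ u → IsPrefix u ⟦ P ++ P ++ Z ⟧) (runPrefixes P i Q)
  runPrefixes-⊑ = subst (λ r → All (λ u → IsPrefix u r) (runPrefixes P i Q)) square-⟦⟧
                        (squarePrefixes-⊑ {⟦ P ⟧} {⟦ Z ⟧})

  runPrefixes-⊒ : All (IsPrefix ⟦ P ++ P ⟧) (runPrefixes P i Q)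
  runPrefixes-⊒ = subst (λ r → All (IsPrefix r) (runPrefixes P i Q)) (sym (⟦⟧-++ P P))
                        (squarePrefixes-⊒ {⟦ P ⟧} {⟦ Z ⟧})

  runPrefixes-distinct : AllPairs _≢_ (runPrefixes P i Q)
  runPrefixes-distinct = squarePrefixes-distinct {⟦ P ⟧} {⟦ Z ⟧}

  runPrefixes-profile : IsPrefix ⟦ A c ∷ B ∷ A d ∷ B ∷ [] ⟧ ⟦ P ++ P ⟧ →
                        All (λ u → profile u ≡ (c , d)) (runPrefixes P i Q)
  runPrefixes-profile head⊑PP =
    All.map (λ PP⊑u → profile-prefix (prefix-trans head⊑PP PP⊑u)) runPrefixes-⊒

  length-runPrefixes : length (runPrefixes P i Q) ≡ suc (i * size P + size Q)
  length-runPrefixes = begin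
    length (runPrefixes P i Q)                      ≡⟨ length-applyDownFrom _ _ ⟩
    suc (length ⟦ Z ⟧)                              ≡⟨ cong suc (length-⟦⟧ Z) ⟩
    suc (size Z)                                    ≡⟨ cong suc (size-++ (concat (replicate i P)) Q) ⟩
    suc (size (concat (replicate i P)) + size Q)    ≡⟨ cong (λ n → suc (n + size Q)) (size-^^ P i) ⟩
    suc (i * size P + size Q)                       ∎
    where open ≡-Reasoning

uˢ wˢ : ℕ → List Seg
uˢ k = A (suc k) ∷ B ∷ A k ∷ B ∷ []
wˢ k = concat (replicate 4 (uˢ k)) ++ A k ∷ []

wₙ≡⟦wˢ⟧ : ∀ k → wₙ (suc k) ≡ ⟦ wˢ k ⟧
wₙ≡⟦wˢ⟧ k = begin
  (⟦ uˢ k ⟧ ^^ 4) ++ aⁿ k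
    ≡⟨ cong₂ _++_ (⟦⟧-^^ (uˢ k) 4) (sym (++-identityʳ (aⁿ k))) ⟩
  ⟦ concat (replicate 4 (uˢ k)) ⟧ ++ ⟦ A k ∷ [] ⟧
    ≡⟨ ⟦⟧-++ (concat (replicate 4 (uˢ k))) (A k ∷ []) ⟨
  ⟦ wˢ k ⟧
    ∎
  where open ≡-Reasoning

length-wₙ : ∀ k → length (wₙ (suc k)) ≡ 9 * suc k + 3
length-wₙ k = begin
  length (wₙ (suc k))                          ≡⟨ cong length (wₙ≡⟦wˢ⟧ k) ⟩
  length ⟦ wˢ k ⟧                              ≡⟨ length-⟦⟧ (wˢ k) ⟩
  size (wˢ k)                                  ≡⟨ size-++ (concat (replicate 4 (uˢ k))) (A k ∷ []) ⟩
  size (concat (replicate 4 (uˢ k))) + (k + 0) ≡⟨ cong (_+ (k + 0)) (size-^^ (uˢ k) 4) ⟩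
  4 * (suc k + suc (k + suc 0)) + (k + 0)      ≡⟨ solve (k ∷ []) ⟩
  9 * suc k + 3                                ∎
  where open ≡-Reasoning

N≤length-wₙ : ∀ N → N ≤ length (wₙ (suc N))
N≤length-wₙ N =
  subst (N ≤_) (sym (length-wₙ N)) (≤-trans (m≤m+n N (8 * N + 12)) (≤-reflexive (solve (N ∷ []))))

-- The four runs with first run a^(t+1)

module Block (k t j : ℕ) where
  P₁ P₂ P₃ P₄ Q₁ Q₂ Q₃ Q₄ : List Seg
  P₁ = A (suc t) ∷ B ∷ A j ∷ []
  P₂ = A (suc t) ∷ B ∷ A (suc j) ∷ []
  P₃ = A (suc t) ∷ B ∷ A k ∷ B ∷ A (suc j) ∷ []
  P₄ = A (suc t) ∷ B ∷ A (suc k) ∷ B ∷ A j ∷ []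
  Q₁ = A (suc t) ∷ []
  Q₂ = A t ∷ []
  Q₃ = A t ∷ []
  Q₄ = A (suc t) ∷ B ∷ A k ∷ []

  F₁ F₂ F₃ F₄ block : List Word
  F₁ = runPrefixes P₁ 0 Q₁
  F₂ = runPrefixes P₂ 0 Q₂
  F₃ = runPrefixes P₃ 2 Q₃
  F₄ = runPrefixes P₄ 1 Q₄
  block = (F₁ ++ F₃) ++ (F₂ ++ F₄)

  length-block : length block ≡ 4 * k + 7 * t + 3 * j + 19
  length-block = begin
    length ((F₁ ++ F₃) ++ (F₂ ++ F₄))
      ≡⟨ length-++ (F₁ ++ F₃) ⟩
    length (F₁ ++ F₃) + length (F₂ ++ F₄)
      ≡⟨ cong₂ _+_ (length-++ F₁) (length-++ F₂) ⟩
    (length F₁ + length F₃) + (length F₂ + length F₄)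
      ≡⟨ cong₂ _+_ (cong₂ _+_ length-F₁ length-F₃) (cong₂ _+_ length-F₂ length-F₄) ⟩
    (suc (suc t) + suc (2 * (suc t + k + suc j + 2) + t))
      + (suc t + suc ((suc t + suc k + j + 2) + (suc t + k + 1)))
      ≡⟨ solve (k ∷ t ∷ j ∷ []) ⟩
    4 * k + 7 * t + 3 * j + 19
      ∎
    where
      open ≡-Reasoning
      length-F₁ : length F₁ ≡ suc (suc t)
      length-F₁ = trans (length-runPrefixes P₁ 0 Q₁) (cong suc (+-identityʳ (suc t)))
      length-F₂ : length F₂ ≡ suc t
      length-F₂ = trans (length-runPrefixes P₂ 0 Q₂) (cong suc (+-identityʳ t))
      length-F₃ : length F₃ ≡ suc (2 * (suc t + k + suc j + 2) + t)
      length-F₃ = trans (length-runPrefixes P₃ 2 Q₃)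
        (cong₂ (λ m n → suc (2 * m + n)) (size-ababa (suc t) k (suc j)) (+-identityʳ t))
      length-F₄ : length F₄ ≡ suc ((suc t + suc k + j + 2) + (suc t + k + 1))
      length-F₄ = trans (length-runPrefixes P₄ 1 Q₄)
        (cong₂ (λ m n → suc (m + n)) (trans (*-identityˡ (size P₄)) (size-ababa (suc t) (suc k) j))
                                     (size-aba (suc t) k))

  Q₁⊑P₁ : IsPrefix ⟦ Q₁ ⟧ ⟦ P₁ ⟧
  Q₁⊑P₁ = runs-prefix Q₁ (B ∷ A j ∷ []) P₁ refl
  Q₂⊑P₂ : IsPrefix ⟦ Q₂ ⟧ ⟦ P₂ ⟧
  Q₂⊑P₂ = runs-prefix Q₂ (A 1 ∷ B ∷ A (suc j) ∷ []) P₂ refl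
  Q₃⊑P₃ : IsPrefix ⟦ Q₃ ⟧ ⟦ P₃ ⟧
  Q₃⊑P₃ = runs-prefix Q₃ (A 1 ∷ B ∷ A k ∷ B ∷ A (suc j) ∷ []) P₃ refl
  Q₄⊑P₄ : IsPrefix ⟦ Q₄ ⟧ ⟦ P₄ ⟧
  Q₄⊑P₄ = runs-prefix Q₄ (A 1 ∷ B ∷ A j ∷ []) P₄ refl

  factor-wₙ : ∀ xs us ys → runs (xs ++ us ++ ys) ≡ runs (wˢ k) → IsFactor ⟦ us ⟧ (wₙ (suc k))
  factor-wₙ xs us ys e =
    subst (IsFactor ⟦ us ⟧) (sym (wₙ≡⟦wˢ⟧ k)) (runs-factor xs us ys (wˢ k) e)

  module _ (1+t+j≡k : suc (t + j) ≡ k) where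
    private
      t+1+j≡k : t + suc j ≡ k
      t+1+j≡k = trans (+-suc t j) 1+t+j≡k

    run₁⊆wₙ : IsFactor ⟦ P₁ ++ P₁ ++ Q₁ ⟧ (wₙ (suc k))
    run₁⊆wₙ = factor-wₙ (A (suc j) ∷ []) (P₁ ++ P₁ ++ Q₁)
      (A 1 ∷ B ∷ A k ∷ B ∷ A (suc k) ∷ B ∷ A k ∷ B ∷ A (suc k) ∷ B ∷ A k ∷ B ∷ A k ∷ [])
      (cong₂ (λ x y → suc y , x ∷ suc x ∷ k ∷ suc k ∷ k ∷ suc k ∷ k ∷ k ∷ []) 1+t+j≡k t+1+j≡k)

    run₂⊆wₙ : IsFactor ⟦ P₂ ++ P₂ ++ Q₂ ⟧ (wₙ (suc k))
    run₂⊆wₙ = factor-wₙ (A (suc k) ∷ B ∷ A j ∷ []) (P₂ ++ P₂ ++ Q₂)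
      (B ∷ A (suc k) ∷ B ∷ A k ∷ B ∷ A (suc k) ∷ B ∷ A k ∷ B ∷ A k ∷ [])
      (cong₂ (λ x y → suc k , x ∷ suc y ∷ y ∷ suc k ∷ k ∷ suc k ∷ k ∷ k ∷ []) 1+t+j≡k t+1+j≡k)

    run₃⊆wₙ : IsFactor ⟦ P₃ ++ P₃ ++ P₃ ++ P₃ ++ Q₃ ⟧ (wₙ (suc k))
    run₃⊆wₙ = factor-wₙ (A (suc j) ∷ []) (P₃ ++ P₃ ++ P₃ ++ P₃ ++ Q₃) []
      (cong (λ y → suc y , k ∷ suc y ∷ k ∷ suc y ∷ k ∷ suc y ∷ k ∷ y ∷ []) t+1+j≡k)

    run₄⊆wₙ : IsFactor ⟦ P₄ ++ P₄ ++ P₄ ++ Q₄ ⟧ (wₙ (suc k))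
    run₄⊆wₙ = factor-wₙ (A (suc k) ∷ B ∷ A j ∷ []) (P₄ ++ P₄ ++ P₄ ++ Q₄) []
      (cong (λ x → suc k , x ∷ suc k ∷ x ∷ suc k ∷ x ∷ suc k ∷ x ∷ k ∷ []) 1+t+j≡k)

    block-rationalFactors : All (RationalFactor (wₙ (suc k))) block
    block-rationalFactors = All.++⁺
      (All.++⁺ (runPrefixes-rationalFactors P₁ 0 Q₁ (λ ()) Q₁⊑P₁ run₁⊆wₙ)
               (runPrefixes-rationalFactors P₃ 2 Q₃ (λ ()) Q₃⊑P₃ run₃⊆wₙ))
      (All.++⁺ (runPrefixes-rationalFactors P₂ 0 Q₂ (λ ()) Q₂⊑P₂ run₂⊆wₙ)
               (runPrefixes-rationalFactors P₄ 1 Q₄ (λ ()) Q₄⊑P₄ run₄⊆wₙ))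

    F₁₃-profile : All (λ u → profile u ≡ (suc t , k)) (F₁ ++ F₃)
    F₁₃-profile = All.++⁺
      (runPrefixes-profile P₁ 0 Q₁
        (runs-prefix H (A j ∷ []) (P₁ ++ P₁) (cong (λ x → suc t , x ∷ j ∷ []) (sym 1+t+j≡k))))
      (runPrefixes-profile P₃ 2 Q₃ (runs-prefix H (A (suc j) ∷ P₃) (P₃ ++ P₃) refl))
      where H = A (suc t) ∷ B ∷ A k ∷ B ∷ []

    F₂₄-profile : All (λ u → profile u ≡ (suc t , suc k)) (F₂ ++ F₄)
    F₂₄-profile = All.++⁺
      (runPrefixes-profile P₂ 0 Q₂
        (runs-prefix H (A (suc j) ∷ []) (P₂ ++ P₂) (cong (λ y → suc t , suc y ∷ suc j ∷ []) (sym t+1+j≡k))))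
      (runPrefixes-profile P₄ 1 Q₄ (runs-prefix H (A j ∷ P₄) (P₄ ++ P₄) refl))
      where H = A (suc t) ∷ B ∷ A (suc k) ∷ B ∷ []

    block-leadingAs : All (λ u → leadingAs u ≡ suc t) block
    block-leadingAs = All.++⁺ (All.map (cong proj₁) F₁₃-profile) (All.map (cong proj₁) F₂₄-profile)

    block-distinct : AllPairs _≢_ block
    block-distinct =
      distinct-++ (λ e e′ → 1+n≢n (sym (cong proj₂ (trans (sym e) e′)))) F₁₃-profile F₂₄-profile
      (distinct-++ run₁⋢P₃P₃ (runPrefixes-⊑ P₁ 0 Q₁) (runPrefixes-⊒ P₃ 2 Q₃)
                   (runPrefixes-distinct P₁ 0 Q₁) (runPrefixes-distinct P₃ 2 Q₃))
      (distinct-++ run₂⋢P₄P₄ (runPrefixes-⊑ P₂ 0 Q₂) (runPrefixes-⊒ P₄ 1 Q₄)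
                   (runPrefixes-distinct P₂ 0 Q₂) (runPrefixes-distinct P₄ 1 Q₄))
      where
        run₁⋢P₃P₃ : IsPrefix u ⟦ P₁ ++ P₁ ++ Q₁ ⟧ → ¬ IsPrefix ⟦ P₃ ++ P₃ ⟧ u
        run₁⋢P₃P₃ =
          runs-separated (P₁ ++ P₁ ++ Q₁) (A 1 ∷ []) (B ∷ A k ∷ B ∷ A (suc j) ∷ []) (P₃ ++ P₃) (λ ())
          (cong₂ (λ x y → suc t , x ∷ suc y ∷ k ∷ suc j ∷ []) 1+t+j≡k (sym (+-suc t j)))
        run₂⋢P₄P₄ : IsPrefix u ⟦ P₂ ++ P₂ ++ Q₂ ⟧ → ¬ IsPrefix ⟦ P₄ ++ P₄ ⟧ u
        run₂⋢P₄P₄ =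
          runs-separated (P₂ ++ P₂ ++ Q₂) (B ∷ []) (A (suc k) ∷ B ∷ A j ∷ []) (P₄ ++ P₄) (λ ())
          (cong₂ (λ x y → suc t , suc x ∷ y ∷ suc k ∷ j ∷ []) t+1+j≡k (+-suc t j))

blocks : ℕ → ℕ → List Word
blocks k zero    = []
blocks k (suc t) = Block.block k t (k ∸ suc t) ++ blocks k t

blocks-rationalFactors : ∀ k m → m ≤ k → All (RationalFactor (wₙ (suc k))) (blocks k m)
blocks-rationalFactors k zero    _   = All.[]
blocks-rationalFactors k (suc t) t<k = All.++⁺
  (Block.block-rationalFactors k t (k ∸ suc t) (m+[n∸m]≡n t<k))
  (blocks-rationalFactors k t (<⇒≤ t<k))

blocks-leadingAs : ∀ k m → m ≤ k → All (λ u → leadingAs u ≤ m) (blocks k m)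
blocks-leadingAs k zero    _   = All.[]
blocks-leadingAs k (suc t) t<k = All.++⁺
  (All.map ≤-reflexive (Block.block-leadingAs k t (k ∸ suc t) (m+[n∸m]≡n t<k)))
  (All.map m≤n⇒m≤1+n (blocks-leadingAs k t (<⇒≤ t<k)))

blocks-distinct : ∀ k m → m ≤ k → AllPairs _≢_ (blocks k m)
blocks-distinct k zero    _   = AllPairs.[]
blocks-distinct k (suc t) t<k = distinct-++ (λ e ≤t → 1+n≰n (subst (_≤ t) e ≤t))
  (Block.block-leadingAs k t (k ∸ suc t) (m+[n∸m]≡n t<k)) (blocks-leadingAs k t (<⇒≤ t<k))
  (Block.block-distinct k t (k ∸ suc t) (m+[n∸m]≡n t<k)) (blocks-distinct k t (<⇒≤ t<k))

length-blocks : ∀ k m → m ≤ k → length (blocks k m) ≡ m * (7 * k + 14) + 2 * m * m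
length-blocks k zero    _   = refl
length-blocks k (suc t) t<k = begin
  length (Block.block k t j ++ blocks k t)
    ≡⟨ length-++ (Block.block k t j) ⟩
  length (Block.block k t j) + length (blocks k t)
    ≡⟨ cong₂ _+_ (Block.length-block k t j) (length-blocks k t (<⇒≤ t<k)) ⟩
  (4 * k + 7 * t + 3 * j + 19) + (t * (7 * k + 14) + 2 * t * t)
    ≡⟨ add-block j k (m+[n∸m]≡n t<k) ⟩
  suc t * (7 * k + 14) + 2 * suc t * suc t
    ∎
  where
    open ≡-Reasoning
    j : ℕ
    j = k ∸ suc t
    add-block : ∀ j k → suc (t + j) ≡ k →
                (4 * k + 7 * t + 3 * j + 19) + (t * (7 * k + 14) + 2 * t * t)
                  ≡ suc t * (7 * k + 14) + 2 * suc t * suc t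
    add-block j _ refl = solve (t ∷ j ∷ [])

RP-wₙ : ∀ k → RP≥ (wₙ (suc k)) (k * (7 * k + 14) + 2 * k * k)
RP-wₙ k =
  blocks k k , length-blocks k k ≤-refl , blocks-distinct k k ≤-refl , blocks-rationalFactors k k ≤-refl

RP-wₙ-bound : ∀ k → ∃ λ m → RP≥ (wₙ (suc k)) m ×
              length (wₙ (suc k)) * length (wₙ (suc k)) ≤ 9 * m + 9 * 2 * length (wₙ (suc k))
RP-wₙ-bound k = k * (7 * k + 14) + 2 * k * k , RP-wₙ k ,
  subst (λ ℓ → ℓ * ℓ ≤ 9 * (k * (7 * k + 14) + 2 * k * k) + 9 * 2 * ℓ) (sym (length-wₙ k))
        (≤-trans (m≤m+n _ (72 * k + 72)) (≤-reflexive (solve (k ∷ []))))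

mainTheorem10 :
    (∀ (n : ℕ) → n ≥ 1 → length (wₙ n) ≡ 9 * n + 3)
    × (∃ λ (C : ℕ) →
        (∀ (n : ℕ) → n ≥ 1 → ∃ λ (m : ℕ) →
            RP≥ (wₙ n) m × length (wₙ n) * length (wₙ n) ≤ 9 * m + 9 * C * length (wₙ n))
        × (∀ (N : ℕ) → ∃ λ (w : Word) → ∃ λ (m : ℕ) →
            N ≤ length w × RP≥ w m × length w * length w ≤ 9 * m + 9 * C * length w))
mainTheorem10 =
  (λ { (suc k) _ → length-wₙ k }) ,
  2 ,
  (λ { (suc k) _ → RP-wₙ-bound k }) ,
  λ N → let m , rp , bound = RP-wₙ-bound N in wₙ (suc N) , m , N≤length-wₙ N , rp , bound
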